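{- For every prime $p$ and every $T\ge 1$, let $Q_{T,p}$ be the number of pairs $(u_1/v_1,u_2/v_2)\in\mathcal{F}(T)\times\mathcal{F}(T)$ with $\gcd(v_1v_2,p)=1$ and $u_1v_1^{ -1}\equiv u_2v_2^{ -1}\pmod p$. Then $$Q_{T,p}\ll T^4/p+T^2(\log p)^2=T^4/p+T^2p^{o(1)},$$ where the implied constant is independent of $p$ and $T$.
   Context: $\mathcal{F}(T)=\{u/v\in\mathbb{Q}: \gcd(u,v)=1,\ 1\le u,v\le T\}$. $p^{o(1)}$ denotes a factor at most $p^{\eta}$ for every fixed $\eta>0$ once $p$ is large enough. -}

module Defs where

open import Data.Nat using (ℕ; suc; _*_; _%_; NonZero)
open import Data.Nat.Properties using (_≟_)
open import Data.Nat.GCD using (gcd)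
open import Data.List using (List; map; upTo; filter; length; cartesianProduct)
open import Data.Product using (_×_; _,_)
open import Relation.Binary.PropositionalEquality using (_≡_)
open import Relation.Nullary using (Dec)
open import Relation.Nullary.Decidable using (_×-dec_)

range : ℕ → List ℕ
range T = map suc (upTo T)

Reduced : ℕ × ℕ → Set
Reduced (u , v) = gcd u v ≡ 1

reduced? : (x : ℕ × ℕ) → Dec (Reduced x)
reduced? (u , v) = gcd u v ≟ 1

-- F(T) : reduced fractions u/v with 1 ≤ u, v ≤ T, each represented once by (u , v)
Farey : ℕ → List (ℕ × ℕ)
Farey T = filter reduced? (cartesianProduct (range T) (range T))

-- gcd(v1 v2, p) = 1 and u1 v1⁻¹ ≡ u2 v2⁻¹ (mod p), the latter written
-- (equivalently, since v1, v2 are invertible mod p) as u1 v2 ≡ u2 v1 (mod p)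
Good : (p : ℕ) .{{_ : NonZero p}} → (ℕ × ℕ) × (ℕ × ℕ) → Set
Good p ((u₁ , v₁) , (u₂ , v₂)) = (gcd (v₁ * v₂) p ≡ 1) × ((u₁ * v₂) % p ≡ (u₂ * v₁) % p)

good? : (p : ℕ) .{{_ : NonZero p}} → (x : (ℕ × ℕ) × (ℕ × ℕ)) → Dec (Good p x)
good? p ((u₁ , v₁) , (u₂ , v₂)) = (gcd (v₁ * v₂) p ≟ 1) ×-dec ((u₁ * v₂) % p ≟ (u₂ * v₁) % p)

Q : (T p : ℕ) .{{_ : NonZero p}} → ℕ
Q T p = length (filter (good? p) (cartesianProduct (Farey T) (Farey T)))

module Submission where

-- Write x = u₀/v₀ and y = u/v for elements of F(T), and call a
-- pair (x , y) *congruent-below* when u₀v ≡ uv₀ (mod p) and v ≤ v₀.  Every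
-- pair counted by Q is congruent-below either as (x , y) or as (y , x), so
-- Q ≤ 2·R where R counts congruent-below pairs.  Fix x.  For the partners y
-- of x the shifted cross difference  d(y) = u₀v + T² − uv₀  lies in [0, 2T²]
-- and is ≡ T² (mod p), so it is determined by its quotient ⌊d(y)/p⌋, which
-- takes at most 1 + ⌊2T²/p⌋ values.  Moreover d determines y: equal cross
-- differences give u₀(v − v') = (u − u')v₀, and gcd(u₀, v₀) = 1 together
-- with |v − v'| < v₀ forces v = v', u = u'.  Hence R ≤ T²(1 + ⌊2T²/p⌋) and
-- Q·p ≤ 2T²(p + 2T²) = 4T⁴ + 2pT² ≤ 4(T⁴ + pT²⌊log₂ p⌋²) as ⌊log₂ p⌋ ≥ 1.

open import Defs
open import Level using (Level)
open import Data.Nat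
open import Data.Nat.Properties
open import Data.Nat.DivMod
open import Data.Nat.Divisibility using (_∣_; ∣⇒≤; n∣m*n; ∣m+n∣m⇒∣n)
open import Data.Nat.Coprimality using (Coprime; gcd≡1⇒coprime; coprime-divisor)
import Data.Nat.Coprimality as Coprimality
open import Data.Nat.GCD using (gcd)
open import Data.Nat.Primality using (Prime; prime⇒nonTrivial)
open import Data.Nat.Logarithm using (⌊log₂_⌋; ⌊log₂⌋-mono-≤)
open import Data.Nat.Tactic.RingSolver using (solve-∀)
open import Data.List using (List; []; _∷_; _++_; map; filter; length; upTo; cartesianProduct)
open import Data.List.Properties using (length-++; length-map; length-upTo; length-filter; filter-++; filter-notAll)
open import Data.List.Membership.Propositional using (_∈_)
open import Data.List.Membership.Propositional.Properties
  using (∈-filter⁺; ∈-filter⁻; ∈-map⁺; ∈-map⁻; ∈-upTo⁺; ∈-upTo⁻; ∈-++⁺ˡ; ∈-++⁺ʳ; ∈-cartesianProduct⁺; ∈-cartesianProduct⁻)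
open import Data.List.Relation.Unary.Any using (here; there)
import Data.List.Relation.Unary.Any as Any
import Data.List.Relation.Unary.All as All
open import Data.List.Relation.Unary.AllPairs using (_∷_)
open import Data.List.Relation.Unary.Unique.Propositional using (Unique)
import Data.List.Relation.Unary.Unique.Propositional.Properties as Unique
open import Data.Product using (Σ; _×_; _,_; proj₁; proj₂; swap)
import Data.Product
open import Data.Product.Properties using (,-injectiveʳ; ≡-dec)
open import Data.Sum using (_⊎_; inj₁; inj₂)
open import Data.Empty using (⊥-elim)
open import Function using (_∘_)
open import Relation.Nullary using (¬?)
open import Relation.Nullary.Decidable using (_×-dec_)
open import Relation.Unary using (Pred; Decidable)
open import Relation.Binary.Definitions using (DecidableEquality)
open import Relation.Binary.PropositionalEquality

private
  variable
    ℓ : Level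
    A B : Set

pigeonhole : (_≟ᴮ_ : DecidableEquality B) (f : A → B) {xs : List A} {ys : List B} →
             Unique xs → (∀ {x y} → x ∈ xs → y ∈ xs → f x ≡ f y → x ≡ y) →
             (∀ {x} → x ∈ xs → f x ∈ ys) → length xs ≤ length ys
pigeonhole _≟ᴮ_ f {[]} _ _ _ = z≤n
pigeonhole _≟ᴮ_ f {x ∷ xs} {ys} (x∉xs ∷ unique) injective maps-into = begin-strict
  length xs                       ≤⟨ pigeonhole _≟ᴮ_ f unique (λ a b → injective (there a) (there b)) maps-into-rest ⟩
  length (filter differs? ys)     <⟨ filter-notAll differs? ys (Any.map (λ fx≡y y≢fx → y≢fx (sym fx≡y)) (maps-into (here refl))) ⟩
  length ys                       ∎
  where
  open ≤-Reasoning
  differs? : Decidable (λ y → y ≢ f x)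
  differs? y = ¬? (y ≟ᴮ f x)
  -- the remaining elements are sent away from f x, by injectivity and x ∉ xs
  maps-into-rest : ∀ {a} → a ∈ xs → f a ∈ filter differs? ys
  maps-into-rest a∈xs = ∈-filter⁺ differs? (maps-into (there a∈xs))
    (λ fa≡fx → All.lookup x∉xs a∈xs (sym (injective (there a∈xs) (here refl) fa≡fx)))

count-by-rows : {P : Pred (A × B) ℓ} (P? : Decidable P) (xs : List A) (ys : List B) (K : ℕ) →
                (∀ {x} → x ∈ xs → length (filter P? (map (x ,_) ys)) ≤ K) →
                length (filter P? (cartesianProduct xs ys)) ≤ length xs * K
count-by-rows P? [] ys K _ = z≤n
count-by-rows P? (x ∷ xs) ys K row-bound = begin
  length (filter P? (map (x ,_) ys ++ cartesianProduct xs ys))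
    ≡⟨ cong length (filter-++ P? (map (x ,_) ys) (cartesianProduct xs ys)) ⟩
  length (filter P? (map (x ,_) ys) ++ filter P? (cartesianProduct xs ys))
    ≡⟨ length-++ (filter P? (map (x ,_) ys)) ⟩
  length (filter P? (map (x ,_) ys)) + length (filter P? (cartesianProduct xs ys))
    ≤⟨ +-mono-≤ (row-bound (here refl)) (count-by-rows P? xs ys K (row-bound ∘ there)) ⟩
  K + length xs * K ∎
  where open ≤-Reasoning

residue-quotient-injective : ∀ {m n} p .{{_ : NonZero p}} → m % p ≡ n % p → m / p ≡ n / p → m ≡ n
residue-quotient-injective {m} {n} p same-residue same-quotient = begin
  m                   ≡⟨ m≡m%n+[m/n]*n m p ⟩
  m % p + m / p * p   ≡⟨ cong₂ (λ r q → r + q * p) same-residue same-quotient ⟩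
  n % p + n / p * p   ≡⟨ m≡m%n+[m/n]*n n p ⟨
  n                   ∎
  where open ≡-Reasoning

congruent⇒balanced : ∀ p .{{_ : NonZero p}} a b → a % p ≡ b % p → a + b / p * p ≡ b + a / p * p
congruent⇒balanced p a b a≡b = begin
  a + b / p * p                     ≡⟨ cong (_+ b / p * p) (m≡m%n+[m/n]*n a p) ⟩
  (a % p + a / p * p) + b / p * p   ≡⟨ cong (λ r → (r + a / p * p) + b / p * p) a≡b ⟩
  (b % p + a / p * p) + b / p * p   ≡⟨ exchange (b % p) (a / p * p) (b / p * p) ⟩
  (b % p + b / p * p) + a / p * p   ≡⟨ cong (_+ a / p * p) (m≡m%n+[m/n]*n b p) ⟨
  b + a / p * p                     ∎
  where
  open ≡-Reasoning
  exchange : ∀ r s t → (r + s) + t ≡ (r + t) + s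
  exchange = solve-∀

shifted-difference-residue : ∀ p .{{_ : NonZero p}} a b n → b ≤ n → a % p ≡ b % p →
                             (a + n ∸ b) % p ≡ n % p
shifted-difference-residue p a b n b≤n a≡b = begin
  d % p                 ≡⟨ [m+kn]%n≡m%n d (b / p) p ⟨
  (d + b / p * p) % p   ≡⟨ cong (_% p) balanced ⟩
  (n + a / p * p) % p   ≡⟨ [m+kn]%n≡m%n n (a / p) p ⟩
  n % p                 ∎
  where
  open ≡-Reasoning
  d : ℕ
  d = a + n ∸ b
  d+b≡a+n : d + b ≡ a + n
  d+b≡a+n = m∸n+n≡m (≤-trans b≤n (m≤n+m n a))
  rearrange₁ : ∀ d k b → (d + k) + b ≡ (d + b) + k
  rearrange₁ = solve-∀
  rearrange₂ : ∀ a n k → (a + n) + k ≡ (a + k) + n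
  rearrange₂ = solve-∀
  rearrange₃ : ∀ b k n → (b + k) + n ≡ (n + k) + b
  rearrange₃ = solve-∀
  balanced : d + b / p * p ≡ n + a / p * p
  balanced = +-cancelʳ-≡ b _ _ (begin
    (d + b / p * p) + b   ≡⟨ rearrange₁ d (b / p * p) b ⟩
    (d + b) + b / p * p   ≡⟨ cong (_+ b / p * p) d+b≡a+n ⟩
    (a + n) + b / p * p   ≡⟨ rearrange₂ a n (b / p * p) ⟩
    (a + b / p * p) + n   ≡⟨ cong (_+ n) (congruent⇒balanced p a b a≡b) ⟩
    (b + a / p * p) + n   ≡⟨ rearrange₃ b (a / p * p) n ⟩
    (n + a / p * p) + b   ∎)

-- Equal shifted differences mean equal cross sums: a + n − b = a' + n − b'
-- gives a + b' = a' + b (for b, b' ≤ n, so that no truncation occurs).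
shifted-difference-injective : ∀ {a b a' b'} n → b ≤ n → b' ≤ n →
                               a + n ∸ b ≡ a' + n ∸ b' → a + b' ≡ a' + b
shifted-difference-injective {a} {b} {a'} {b'} n b≤n b'≤n same = +-cancelʳ-≡ n _ _ (begin
  (a + b') + n                ≡⟨ rearrange₁ a b' n ⟩
  (a + n) + b'                ≡⟨ cong (_+ b') (m∸n+n≡m (≤-trans b≤n (m≤n+m n a))) ⟨
  ((a + n ∸ b) + b) + b'      ≡⟨ cong (λ d → (d + b) + b') same ⟩
  ((a' + n ∸ b') + b) + b'    ≡⟨ rearrange₂ (a' + n ∸ b') b b' ⟩
  ((a' + n ∸ b') + b') + b    ≡⟨ cong (_+ b) (m∸n+n≡m (≤-trans b'≤n (m≤n+m n a'))) ⟩
  (a' + n) + b                ≡⟨ rearrange₁ a' b n ⟨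
  (a' + b) + n                ∎)
  where
  open ≡-Reasoning
  rearrange₁ : ∀ a b n → (a + b) + n ≡ (a + n) + b
  rearrange₁ = solve-∀
  rearrange₂ : ∀ d b b' → (d + b) + b' ≡ (d + b') + b
  rearrange₂ = solve-∀

shifted-quotient-injective : ∀ p .{{_ : NonZero p}} n {a b a' b'} → b ≤ n → b' ≤ n →
                             a % p ≡ b % p → a' % p ≡ b' % p →
                             (a + n ∸ b) / p ≡ (a' + n ∸ b') / p → a + b' ≡ a' + b
shifted-quotient-injective p n {a} {b} {a'} {b'} b≤n b'≤n a≡b a'≡b' same-quotient =
  shifted-difference-injective n b≤n b'≤n
    (residue-quotient-injective p
      (trans (shifted-difference-residue p a b n b≤n a≡b) (sym (shifted-difference-residue p a' b' n b'≤n a'≡b')))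
      same-quotient)

small-multiple≡0 : ∀ {v₀ e} → v₀ ∣ e → e < v₀ → e ≡ 0
small-multiple≡0 {e = zero}  _      _   = refl
small-multiple≡0 {e = suc _} v₀∣e e<v₀ = ⊥-elim (<⇒≱ e<v₀ (∣⇒≤ v₀∣e))

-- Core case: if u₀(v' + e) + u'v₀ = u₀v' + uv₀ with v₀ coprime to u₀ and
-- 0 ≤ e < v₀, then v₀ ∣ u₀e forces e = 0, and then u = u'.
cross-difference-gap : ∀ {u₀ v₀ u u' v' e} → Coprime v₀ u₀ → e < v₀ →
                       u₀ * (v' + e) + u' * v₀ ≡ u₀ * v' + u * v₀ → u ≡ u' × e ≡ 0
cross-difference-gap {u₀} {v₀} {u} {u'} {v'} {e} coprime e<v₀ cross = u≡u' , e≡0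
  where
  expand : ∀ a b c d f → a * (b + c) + d * f ≡ a * b + (d * f + a * c)
  expand = solve-∀
  cancelled : u' * v₀ + u₀ * e ≡ u * v₀
  cancelled = +-cancelˡ-≡ (u₀ * v') _ _ (trans (sym (expand u₀ v' e u' v₀)) cross)
  e≡0 : e ≡ 0
  e≡0 = small-multiple≡0 (coprime-divisor coprime
          (∣m+n∣m⇒∣n (subst (v₀ ∣_) (sym cancelled) (n∣m*n u)) (n∣m*n u'))) e<v₀
  u≡u' : u ≡ u'
  u≡u' = *-cancelʳ-≡ u u' v₀ {{>-nonZero (≤-<-trans z≤n e<v₀)}} (begin
    u * v₀                ≡⟨ cancelled ⟨
    u' * v₀ + u₀ * e      ≡⟨ cong (λ k → u' * v₀ + u₀ * k) e≡0 ⟩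
    u' * v₀ + u₀ * 0      ≡⟨ cong (u' * v₀ +_) (*-zeroʳ u₀) ⟩
    u' * v₀ + 0           ≡⟨ +-identityʳ (u' * v₀) ⟩
    u' * v₀               ∎)
    where open ≡-Reasoning

-- The case v' ≤ v of the injectivity below: set e = v − v' < v₀.
cross-difference-ordered : ∀ u₀ v₀ {u v u' v'} → gcd u₀ v₀ ≡ 1 → 1 ≤ v' → v' ≤ v → v ≤ v₀ →
                           u₀ * v + u' * v₀ ≡ u₀ * v' + u * v₀ → u ≡ u' × v ≡ v'
cross-difference-ordered u₀ v₀ {u} {v} {u'} {v'} reduced 1≤v' v'≤v v≤v₀ cross =
  u≡u' , trans v≡v'+gap (trans (cong (v' +_) gap≡0) (+-identityʳ v'))
  where
  v≡v'+gap : v ≡ v' + (v ∸ v')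
  v≡v'+gap = sym (m+[n∸m]≡n v'≤v)
  gap<v₀ : v ∸ v' < v₀
  gap<v₀ = <-≤-trans (∸-monoʳ-< 1≤v' v'≤v) v≤v₀
  determined : u ≡ u' × v ∸ v' ≡ 0
  determined = cross-difference-gap (Coprimality.sym (gcd≡1⇒coprime {u₀} {v₀} reduced)) gap<v₀
                 (subst (λ w → u₀ * w + u' * v₀ ≡ u₀ * v' + u * v₀) v≡v'+gap cross)
  u≡u' : u ≡ u'
  u≡u' = proj₁ determined
  gap≡0 : v ∸ v' ≡ 0
  gap≡0 = proj₂ determined

-- For a reduced fraction u₀/v₀, the cross difference u₀v − uv₀ determines the
-- pair (u , v) among pairs with 1 ≤ v ≤ v₀ (written without subtraction).
cross-difference-injective : ∀ u₀ v₀ {u v u' v'} → gcd u₀ v₀ ≡ 1 →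
                             1 ≤ v → 1 ≤ v' → v ≤ v₀ → v' ≤ v₀ →
                             u₀ * v + u' * v₀ ≡ u₀ * v' + u * v₀ → u ≡ u' × v ≡ v'
cross-difference-injective u₀ v₀ {v = v} {v' = v'} reduced 1≤v 1≤v' v≤v₀ v'≤v₀ cross with ≤-total v' v
... | inj₁ v'≤v = cross-difference-ordered u₀ v₀ reduced 1≤v' v'≤v v≤v₀ cross
... | inj₂ v≤v' = Data.Product.map sym sym (cross-difference-ordered u₀ v₀ reduced 1≤v v≤v' v'≤v₀ (sym cross))

range-length : ∀ T → length (range T) ≡ T
range-length T = trans (length-map suc (upTo T)) (length-upTo T)

range-unique : ∀ T → Unique (range T)
range-unique T = Unique.map⁺ suc-injective (Unique.upTo⁺ T)

range-bounds : ∀ T {i} → i ∈ range T → 1 ≤ i × i ≤ T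
range-bounds T i∈range with j , j∈upTo , refl ← ∈-map⁻ suc i∈range = s≤s z≤n , ∈-upTo⁻ j∈upTo

record FareyMember (T u v : ℕ) : Set where
  field
    reduced       : gcd u v ≡ 1
    numerator≤T   : u ≤ T
    1≤denominator : 1 ≤ v
    denominator≤T : v ≤ T

farey-member : ∀ T {u v} → (u , v) ∈ Farey T → FareyMember T u v
farey-member T {u} {v} x∈F
  with x∈product , reduced ← ∈-filter⁻ reduced? {xs = cartesianProduct (range T) (range T)} x∈F
  with u∈range , v∈range ← ∈-cartesianProduct⁻ (range T) (range T) x∈product
  = record { reduced       = reduced
           ; numerator≤T   = proj₂ (range-bounds T u∈range)
           ; 1≤denominator = proj₁ (range-bounds T v∈range)
           ; denominator≤T = proj₂ (range-bounds T v∈range) }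

farey-unique : ∀ T → Unique (Farey T)
farey-unique T = Unique.filter⁺ reduced? (Unique.cartesianProduct⁺ (range-unique T) (range-unique T))

farey-size : ∀ T → length (Farey T) ≤ T * T
farey-size T = subst (λ n → length (Farey T) ≤ n * T) (range-length T)
  (count-by-rows reduced? (range T) (range T) T row-bound)
  where
  row-bound : ∀ {u} → u ∈ range T → length (filter reduced? (map (u ,_) (range T))) ≤ T
  row-bound {u} _ = ≤-trans (length-filter reduced? (map (u ,_) (range T)))
                            (≤-reflexive (trans (length-map (u ,_) (range T)) (range-length T)))

∈-cartesianProduct-swap : ∀ {xs : List A} {ys : List B} {x y} →
                          (x , y) ∈ cartesianProduct xs ys → (y , x) ∈ cartesianProduct ys xs
∈-cartesianProduct-swap {xs = xs} {ys} xy∈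
  with x∈xs , y∈ys ← ∈-cartesianProduct⁻ xs ys xy∈ = ∈-cartesianProduct⁺ y∈ys x∈xs

module _ (p : ℕ) .{{_ : NonZero p}} (T : ℕ) where

  CongruentBelow : (ℕ × ℕ) × (ℕ × ℕ) → Set
  CongruentBelow ((u₀ , v₀) , (u , v)) = (u₀ * v) % p ≡ (u * v₀) % p × v ≤ v₀

  congruentBelow? : Decidable CongruentBelow
  congruentBelow? ((u₀ , v₀) , (u , v)) = ((u₀ * v) % p ≟ (u * v₀) % p) ×-dec (v ≤? v₀)

  crossKey : (ℕ × ℕ) × (ℕ × ℕ) → ℕ
  crossKey ((u₀ , v₀) , (u , v)) = (u₀ * v + T * T ∸ u * v₀) / p

  keyRange : ℕ
  keyRange = suc ((T * T + T * T) / p)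

  -- A fraction of F(T) has at most keyRange congruent-below partners, since
  -- crossKey is injective on them and takes values below keyRange.
  partners-bound : ∀ {x} → x ∈ Farey T →
                   length (filter congruentBelow? (map (x ,_) (Farey T))) ≤ keyRange
  partners-bound {u₀ , v₀} x∈F =
    subst (length partners ≤_) (length-upTo keyRange)
      (pigeonhole _≟_ crossKey (Unique.filter⁺ congruentBelow? (Unique.map⁺ ,-injectiveʳ (farey-unique T)))
                  key-injective (λ z∈ → ∈-upTo⁺ (key-bound z∈)))
    where
    open FareyMember (farey-member T x∈F)
    partners : List ((ℕ × ℕ) × (ℕ × ℕ))
    partners = filter congruentBelow? (map ((u₀ , v₀) ,_) (Farey T))
    partner : ∀ {z} → z ∈ partners →
              Σ (ℕ × ℕ) λ { (u , v) → FareyMember T u v × z ≡ ((u₀ , v₀) , (u , v)) × CongruentBelow z }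
    partner z∈ with z∈row , below ← ∈-filter⁻ congruentBelow? z∈
                with (u , v) , y∈F , refl ← ∈-map⁻ ((u₀ , v₀) ,_) z∈row = (u , v) , farey-member T y∈F , refl , below
    key-injective : ∀ {z z'} → z ∈ partners → z' ∈ partners → crossKey z ≡ crossKey z' → z ≡ z'
    key-injective z∈ z'∈ same-key
      with (u , v) , y , refl , (congruent , v≤v₀) ← partner z∈
         | (u' , v') , y' , refl , (congruent' , v'≤v₀) ← partner z'∈
      with refl , refl ← cross-difference-injective u₀ v₀ {u} {v} {u'} {v'} reduced
             (FareyMember.1≤denominator y) (FareyMember.1≤denominator y') v≤v₀ v'≤v₀
             (shifted-quotient-injective p (T * T)
               (*-mono-≤ (FareyMember.numerator≤T y) denominator≤T)
               (*-mono-≤ (FareyMember.numerator≤T y') denominator≤T)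
               congruent congruent' same-key)
      = refl
    key-bound : ∀ {z} → z ∈ partners → crossKey z < keyRange
    key-bound z∈ with (u , v) , y , refl , _ ← partner z∈ =
      s≤s (/-monoˡ-≤ p (≤-trans (m∸n≤m (u₀ * v + T * T) (u * v₀))
                               (+-monoˡ-≤ (T * T) (*-mono-≤ numerator≤T (FareyMember.denominator≤T y)))))

  pairs : List ((ℕ × ℕ) × (ℕ × ℕ))
  pairs = cartesianProduct (Farey T) (Farey T)

  congruentBelowCount : ℕ
  congruentBelowCount = length (filter congruentBelow? pairs)

  congruentBelowCount-bound : congruentBelowCount ≤ T * T * keyRange
  congruentBelowCount-bound = ≤-trans (count-by-rows congruentBelow? (Farey T) (Farey T) keyRange partners-bound)
                                      (*-monoˡ-≤ keyRange (farey-size T))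

  good⇒congruentBelow : ∀ x y → Good p (x , y) → CongruentBelow (x , y) ⊎ CongruentBelow (y , x)
  good⇒congruentBelow (u₁ , v₁) (u₂ , v₂) (_ , congruent) with ≤-total v₂ v₁
  ... | inj₁ v₂≤v₁ = inj₁ (congruent , v₂≤v₁)
  ... | inj₂ v₁≤v₂ = inj₂ (sym congruent , v₁≤v₂)

  -- Q ≤ 2R: the pairs counted by Q all lie in  below ++ swap(below).
  Q-bound : Q T p ≤ 2 * congruentBelowCount
  Q-bound = begin
    Q T p                                ≤⟨ pigeonhole (≡-dec (≡-dec _≟_ _≟_) (≡-dec _≟_ _≟_)) (λ z → z)
                                              (Unique.filter⁺ (good? p) (Unique.cartesianProduct⁺ (farey-unique T) (farey-unique T)))
                                              (λ _ _ same → same) maps-into ⟩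
    length (below ++ map swap below)     ≡⟨ length-++ below ⟩
    length below + length (map swap below) ≡⟨ cong (length below +_) (length-map swap below) ⟩
    length below + length below          ≡⟨ cong (length below +_) (+-identityʳ (length below)) ⟨
    2 * congruentBelowCount              ∎
    where
    open ≤-Reasoning
    below : List ((ℕ × ℕ) × (ℕ × ℕ))
    below = filter congruentBelow? pairs
    maps-into : ∀ {z} → z ∈ filter (good? p) pairs → z ∈ below ++ map swap below
    maps-into {x , y} z∈ with xy∈pairs , good ← ∈-filter⁻ (good? p) {xs = pairs} z∈ with good⇒congruentBelow x y good
    ... | inj₁ below-xy = ∈-++⁺ˡ (∈-filter⁺ congruentBelow? xy∈pairs below-xy)
    ... | inj₂ below-yx = ∈-++⁺ʳ below (∈-map⁺ swap (∈-filter⁺ congruentBelow? (∈-cartesianProduct-swap {xs = Farey T} {ys = Farey T} xy∈pairs) below-yx))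

suc-quotient-scaled : ∀ n p .{{_ : NonZero p}} → suc (n / p) * p ≤ p + n
suc-quotient-scaled n p = +-monoʳ-≤ p (m/n*n≤m n p)

log₂-prime-positive : ∀ {p} → Prime p → 1 ≤ ⌊log₂ p ⌋
log₂-prime-positive {p} p-prime = ⌊log₂⌋-mono-≤ {2} {p} (nonTrivial⇒n>1 p {{prime⇒nonTrivial p-prime}})

≤-*-square : ∀ m {L} → 1 ≤ L → m ≤ m * L ^ 2
≤-*-square m {L} 1≤L = m≤m*n m (L ^ 2) {{m^n≢0 L 2 {{>-nonZero 1≤L}}}}

lemma2p4 : Σ ℕ (λ C → (p : ℕ) .{{_ : NonZero p}} → Prime p → (T : ℕ) → 1 ≤ T →
    Q T p * p ≤ C * (T ^ 4 + p * T ^ 2 * ⌊log₂ p ⌋ ^ 2))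
lemma2p4 = 4 , λ p p-prime T _ → bound p p-prime T
  where
  regroup : ∀ a b c d → a * (b * c) * d ≡ a * b * (c * d)
  regroup = solve-∀
  -- t ^ 4 and t ^ 2 appear unfolded, as the ring solver does not read _^_
  expand : ∀ t q → 2 * (t * t) * (q + (t * t + t * t)) ≡ 4 * (t * (t * (t * (t * 1)))) + 2 * (q * (t * (t * 1)))
  expand = solve-∀
  bound : (p : ℕ) .{{_ : NonZero p}} → Prime p → (T : ℕ) →
          Q T p * p ≤ 4 * (T ^ 4 + p * T ^ 2 * ⌊log₂ p ⌋ ^ 2)
  bound p p-prime T = begin
    Q T p * p                                  ≤⟨ *-monoˡ-≤ p (≤-trans (Q-bound p T) (*-monoʳ-≤ 2 (congruentBelowCount-bound p T))) ⟩
    2 * (T * T * keyRange p T) * p             ≡⟨ regroup 2 (T * T) (keyRange p T) p ⟩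
    2 * (T * T) * (keyRange p T * p)           ≤⟨ *-monoʳ-≤ (2 * (T * T)) (suc-quotient-scaled (T * T + T * T) p) ⟩
    2 * (T * T) * (p + (T * T + T * T))        ≡⟨ expand T p ⟩
    4 * T ^ 4 + 2 * (p * T ^ 2)                ≤⟨ +-monoʳ-≤ (4 * T ^ 4) (*-mono-≤ {2} {4} (s≤s (s≤s z≤n)) (≤-*-square (p * T ^ 2) (log₂-prime-positive p-prime))) ⟩
    4 * T ^ 4 + 4 * (p * T ^ 2 * ⌊log₂ p ⌋ ^ 2) ≡⟨ *-distribˡ-+ 4 (T ^ 4) (p * T ^ 2 * ⌊log₂ p ⌋ ^ 2) ⟨
    4 * (T ^ 4 + p * T ^ 2 * ⌊log₂ p ⌋ ^ 2)    ∎
    where open ≤-Reasoning
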